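{- Let $n$ and $k$ be positive integers. If $k$ is divisible by $2$, then $|Q(n,k)|\ge 2^{(k/2)^n}$. If $k$ is divisible by $3$, then $|Q(n,k)|\ge (3\cdot 2^n)^{(k/3)^n}>2^{n(k/3)^n}$.
   Context: For a nonempty set $\Sigma$ and a positive integer $n$, an $n$-ary operation $f:\Sigma^n\to\Sigma$ is an $n$-quasigroup if in the equality $z_0=f(z_1,\ldots,z_n)$ knowledge of any $n$ of the elements $z_0,\ldots,z_n$ uniquely specifies the remaining one. $Q(n,k)$ denotes the set of all $n$-quasigroups $\Sigma^n\to\Sigma$ on a fixed set $\Sigma$ with $|\Sigma|=k$. -}

module Defs where

open import Data.Nat using (ℕ)
open import Data.Fin using (Fin; _≟_)
open import Data.Product using (Σ; ∃!)
open import Relation.Nullary using (yes; no)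
open import Relation.Binary.PropositionalEquality using (_≡_)

_[_]≔_ : {n k : ℕ} → (Fin n → Fin k) → Fin n → Fin k → (Fin n → Fin k)
(x [ i ]≔ b) j with j ≟ i
... | yes _ = b
... | no  _ = x j

Op : ℕ → ℕ → Set
Op n k = (Fin n → Fin k) → Fin k

-- f is an n-quasigroup: in z₀ = f(z₁,…,zₙ) any n of z₀,…,zₙ determine the
-- remaining one.  z₀ is determined by z₁..zₙ since f is a function; for each
-- position i, given z₀ = a and the other zⱼ, there is a unique zᵢ = b.
IsQuasigroup : {n k : ℕ} → Op n k → Set
IsQuasigroup {n} {k} f =
  (i : Fin n) (x : Fin n → Fin k) (a : Fin k) → ∃! _≡_ (λ b → f (x [ i ]≔ b) ≡ a)

Q : ℕ → ℕ → Set
Q n k = Σ (Op n k) IsQuasigroup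

-- |Q(n,k)| ≥ N : there is an injection Fin N → Q(n,k), where two
-- quasigroups are equal iff they agree at every point (extensional equality).
CardAtLeast : ℕ → ℕ → ℕ → Set
CardAtLeast n k N =
  Σ (Fin N → Q n k) (λ g → (i j : Fin N) →
      ((x : Fin n → Fin k) → Σ.proj₁ (g i) x ≡ Σ.proj₁ (g j) x) → i ≡ j)

-- Write k = M·p with p ∈ {2, 3}, so that Fin k ≅ Fin M × Fin p.  Take any n-quasigroup g on
-- Fin M and N pairwise distinct n-quasigroups f₁, …, f_N on Fin p.  For every labelling
-- φ : (Fin M)ⁿ → Fin N the map sending (a, e) ∈ (Fin M)ⁿ × (Fin p)ⁿ to (g a, f_{φ a} e) is an
-- n-quasigroup on Fin k (solve first for the Fin M component, then for the Fin p component),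
-- and distinct labellings give distinct quasigroups; this yields N^(Mⁿ) of them.  For p = 2 take
-- the two maps c + x₁ + ⋯ + xₙ (mod 2), N = 2; for p = 3 the maps c + σ₁x₁ + ⋯ + σₙxₙ (mod 3)
-- with each σᵢ the identity or the reflection u ↦ 2 − u, N = 3·2ⁿ.  These are pairwise distinct
-- because on Fin 3 the maps u ↦ u + g and u ↦ (2 − u) + g' never coincide.
module Submission where

open import Data.Fin using (Fin; zero; suc; toℕ; _≟_; combine; quotient; remainder; finToFun; funToFin; opposite)
open import Data.Fin.Permutation using (Permutation′; _⟨$⟩ʳ_; _⟨$⟩ˡ_; inverseˡ; inverseʳ; _≈_; id; reverse)
import Data.Fin.Properties as DFP
open import Data.Fin.Properties using (toℕ-fromℕ<; toℕ-injective; toℕ<n; remQuot-combine; combine-remQuot; funToFin-finToFin)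
open import Data.Nat as ℕ using (ℕ; suc; _+_; _*_; _^_; _∸_; _≥_; _<_; _>_; NonZero; >-nonZero; s≤s; z≤n)
open import Data.Nat.DivMod using (_/_; _%_; _mod_; %-distribˡ-+; m%n%n≡m%n; [m+n]%n≡m%n; m<n⇒m%n≡m; m*n/n≡m; m≥n⇒m/n>0)
open import Data.Nat.Divisibility using (_∣_; divides; ∣⇒≤)
open import Data.Nat.Properties using (+-comm; +-assoc; m∸n+n≡m; m+[n∸m]≡n; <⇒≤; ^-*-assoc; ^-monoˡ-<; m<m*n; *-comm; m^n≢0; m^n>0)
open import Data.Product using (_×_; _,_; proj₁; proj₂)
open import Data.Vec.Functional using (_∷_; tail)
open import Function using (_∘_)
open import Relation.Binary.PropositionalEquality using (_≡_; _≢_; refl; sym; trans; cong; cong₂; subst; module ≡-Reasoning)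
open import Relation.Nullary using (¬_; yes; no; contradiction)

open import Defs

map-[]≔ : ∀ {n k l} (g : Fin k → Fin l) (x : Fin n → Fin k) i b j →
          g ((x [ i ]≔ b) j) ≡ ((g ∘ x) [ i ]≔ g b) j
map-[]≔ g x i b j with j ≟ i
... | yes _ = refl
... | no  _ = refl

tail-[suc]≔ : ∀ {n k} (x : Fin (suc n) → Fin k) i b j →
              tail (x [ suc i ]≔ b) j ≡ (tail x [ i ]≔ b) j
tail-[suc]≔ x i b j with j ≟ i
... | yes _ = refl
... | no  _ = refl

funToFin-cong : ∀ {m n} {f g : Fin m → Fin n} → (∀ j → f j ≡ g j) → funToFin f ≡ funToFin g
funToFin-cong {ℕ.zero} _   = refl
funToFin-cong {suc m} f≗g = cong₂ combine (f≗g zero) (funToFin-cong (f≗g ∘ suc))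

finToFun-injective : ∀ {m n} {t t' : Fin (n ^ m)} →
                     (∀ j → finToFun {n} {m} t j ≡ finToFun t' j) → t ≡ t'
finToFun-injective {m} {n} {t} {t'} t≗t' = begin
  t                              ≡⟨ funToFin-finToFin {m} {n} t ⟨
  funToFin (finToFun {n} {m} t)  ≡⟨ funToFin-cong t≗t' ⟩
  funToFin (finToFun {n} {m} t') ≡⟨ funToFin-finToFin {m} {n} t' ⟩
  t'                             ∎
  where open ≡-Reasoning

-- Without function extensionality, an operation has to be shown to respect
-- pointwise equality of its arguments before it can be composed with others.
record NQuasigroup (n k : ℕ) : Set where
  field
    op           : Op n k
    op-cong      : ∀ {x y} → (∀ j → x j ≡ y j) → op x ≡ op y
    isQuasigroup : IsQuasigroup op

open NQuasigroup

Distinct : ∀ {N n k} → (Fin N → NQuasigroup n k) → Set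
Distinct {N} {n} {k} f = ∀ t t' → (∀ (x : Fin n → Fin k) → op (f t) x ≡ op (f t') x) → t ≡ t'

distinct⇒cardAtLeast : ∀ {N n k} (f : Fin N → NQuasigroup n k) → Distinct f → CardAtLeast n k N
distinct⇒cardAtLeast f f-distinct = (λ t → op (f t) , isQuasigroup (f t)) , f-distinct

module Cyclic (M : ℕ) .{{_ : NonZero M}} where

  infixl 6 _⊕_ _⊖_

  _⊕_ : Fin M → Fin M → Fin M
  u ⊕ v = (toℕ u + toℕ v) mod M

  -- Adding M ∸ u rather than subtracting u avoids truncated subtraction.
  _⊖_ : Fin M → Fin M → Fin M
  c ⊖ u = (toℕ c + (M ∸ toℕ u)) mod M

  ⊕-comm : ∀ u v → u ⊕ v ≡ v ⊕ u
  ⊕-comm u v = cong (_mod M) (+-comm (toℕ u) (toℕ v))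

  private
    [m%M+n]%M≡[m+n]%M : ∀ m n → (m % M + n) % M ≡ (m + n) % M
    [m%M+n]%M≡[m+n]%M m n = begin
      (m % M + n) % M             ≡⟨ %-distribˡ-+ (m % M) n M ⟩
      (m % M % M + n % M) % M     ≡⟨ cong (λ r → (r + n % M) % M) (m%n%n≡m%n m M) ⟩
      (m % M + n % M) % M         ≡⟨ %-distribˡ-+ m n M ⟨
      (m + n) % M                 ∎
      where open ≡-Reasoning

    [c+M]%M≡c : ∀ (c : Fin M) → (toℕ c + M) % M ≡ toℕ c
    [c+M]%M≡c c = trans ([m+n]%n≡m%n (toℕ c) M) (m<n⇒m%n≡m (toℕ<n c))

  c⊖u⊕u≡c : ∀ c u → c ⊖ u ⊕ u ≡ c
  c⊖u⊕u≡c c u = toℕ-injective (begin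
    toℕ (c ⊖ u ⊕ u)                           ≡⟨ toℕ-fromℕ< _ ⟩
    (toℕ (c ⊖ u) + toℕ u) % M                 ≡⟨ cong (λ r → (r + toℕ u) % M) (toℕ-fromℕ< _) ⟩
    ((toℕ c + (M ∸ toℕ u)) % M + toℕ u) % M   ≡⟨ [m%M+n]%M≡[m+n]%M _ (toℕ u) ⟩
    (toℕ c + (M ∸ toℕ u) + toℕ u) % M         ≡⟨ cong (_% M) (+-assoc (toℕ c) _ _) ⟩
    (toℕ c + (M ∸ toℕ u + toℕ u)) % M         ≡⟨ cong (λ r → (toℕ c + r) % M) (m∸n+n≡m (<⇒≤ (toℕ<n u))) ⟩
    (toℕ c + M) % M                           ≡⟨ [c+M]%M≡c c ⟩
    toℕ c                                     ∎)
    where open ≡-Reasoning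

  v⊕u⊖u≡v : ∀ v u → v ⊕ u ⊖ u ≡ v
  v⊕u⊖u≡v v u = toℕ-injective (begin
    toℕ (v ⊕ u ⊖ u)                                 ≡⟨ toℕ-fromℕ< _ ⟩
    (toℕ (v ⊕ u) + (M ∸ toℕ u)) % M                 ≡⟨ cong (λ r → (r + (M ∸ toℕ u)) % M) (toℕ-fromℕ< _) ⟩
    ((toℕ v + toℕ u) % M + (M ∸ toℕ u)) % M         ≡⟨ [m%M+n]%M≡[m+n]%M _ (M ∸ toℕ u) ⟩
    (toℕ v + toℕ u + (M ∸ toℕ u)) % M               ≡⟨ cong (_% M) (+-assoc (toℕ v) _ _) ⟩
    (toℕ v + (toℕ u + (M ∸ toℕ u))) % M             ≡⟨ cong (λ r → (toℕ v + r) % M) (m+[n∸m]≡n (<⇒≤ (toℕ<n u))) ⟩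
    (toℕ v + M) % M                                 ≡⟨ [c+M]%M≡c v ⟩
    toℕ v                                           ∎)
    where open ≡-Reasoning

  u⊕[c⊖u]≡c : ∀ u c → u ⊕ (c ⊖ u) ≡ c
  u⊕[c⊖u]≡c u c = trans (⊕-comm u (c ⊖ u)) (c⊖u⊕u≡c c u)

  ⊕≡⇒≡⊖ʳ : ∀ {v u c} → v ⊕ u ≡ c → v ≡ c ⊖ u
  ⊕≡⇒≡⊖ʳ {v} {u} e = trans (sym (v⊕u⊖u≡v v u)) (cong (_⊖ u) e)

  ⊕≡⇒≡⊖ˡ : ∀ {u v c} → u ⊕ v ≡ c → v ≡ c ⊖ u
  ⊕≡⇒≡⊖ˡ {u} {v} e = ⊕≡⇒≡⊖ʳ (trans (⊕-comm v u) e)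

  ⊕-cancelˡ : ∀ u {v v'} → u ⊕ v ≡ u ⊕ v' → v ≡ v'
  ⊕-cancelˡ u e = trans (⊕≡⇒≡⊖ˡ e) (sym (⊕≡⇒≡⊖ˡ refl))

  ⊕-cancelʳ : ∀ u {v v'} → v ⊕ u ≡ v' ⊕ u → v ≡ v'
  ⊕-cancelʳ u e = trans (⊕≡⇒≡⊖ʳ e) (sym (⊕≡⇒≡⊖ʳ refl))

module Linear (M : ℕ) .{{_ : NonZero M}} where

  open Cyclic M

  linear : ∀ {n} → (Fin n → Permutation′ M) → Fin M → Op n M
  linear {ℕ.zero} π c x = c
  linear {suc n}  π c x = (π zero ⟨$⟩ʳ x zero) ⊕ linear (tail π) c (tail x)

  linear-cong : ∀ {n} (π : Fin n → Permutation′ M) c {x y} →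
                (∀ j → x j ≡ y j) → linear π c x ≡ linear π c y
  linear-cong {ℕ.zero} _ _ _ = refl
  linear-cong {suc n}  π c x≗y =
    cong₂ _⊕_ (cong (π zero ⟨$⟩ʳ_) (x≗y zero)) (linear-cong (tail π) c (x≗y ∘ suc))

  linear-congᵖ : ∀ {n} {π ρ : Fin n → Permutation′ M} c →
                 (∀ j → π j ≈ ρ j) → ∀ x → linear π c x ≡ linear ρ c x
  linear-congᵖ {ℕ.zero} _ _ _ = refl
  linear-congᵖ {suc n}  c π≈ρ x =
    cong₂ _⊕_ (π≈ρ zero (x zero)) (linear-congᵖ c (π≈ρ ∘ suc) (tail x))

  linear-isQuasigroup : ∀ {n} (π : Fin n → Permutation′ M) c → IsQuasigroup (linear π c)
  linear-isQuasigroup π c zero x a = b , solves , unique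
    where
    w = linear (tail π) c (tail x)
    b = π zero ⟨$⟩ˡ (a ⊖ w)
    solves : (π zero ⟨$⟩ʳ b) ⊕ w ≡ a
    solves = trans (cong (_⊕ w) (inverseʳ (π zero))) (c⊖u⊕u≡c a w)
    unique : ∀ {b'} → (π zero ⟨$⟩ʳ b') ⊕ w ≡ a → b ≡ b'
    unique e = trans (cong (π zero ⟨$⟩ˡ_) (sym (⊕≡⇒≡⊖ʳ e))) (inverseˡ (π zero))
  linear-isQuasigroup π c (suc i) x a = b , solves , unique
    where
    h = π zero ⟨$⟩ʳ x zero
    tail-update : ∀ b → linear (tail π) c (tail (x [ suc i ]≔ b)) ≡ linear (tail π) c (tail x [ i ]≔ b)
    tail-update b = linear-cong (tail π) c (tail-[suc]≔ x i b)
    tail-solution = linear-isQuasigroup (tail π) c i (tail x) (a ⊖ h)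
    b = proj₁ tail-solution
    solves : h ⊕ linear (tail π) c (tail (x [ suc i ]≔ b)) ≡ a
    solves = trans (cong (h ⊕_) (trans (tail-update b) (proj₁ (proj₂ tail-solution)))) (u⊕[c⊖u]≡c h a)
    unique : ∀ {b'} → h ⊕ linear (tail π) c (tail (x [ suc i ]≔ b')) ≡ a → b ≡ b'
    unique e = proj₂ (proj₂ tail-solution) (trans (sym (tail-update _)) (⊕≡⇒≡⊖ˡ e))

  linear-const-injective : ∀ {n} (π : Fin n → Permutation′ M) {c c'} →
                           (∀ x → linear π c x ≡ linear π c' x) → c ≡ c'
  linear-const-injective {ℕ.zero} π h = h (λ ())
  linear-const-injective {suc n}  π {c} h =
    linear-const-injective (tail π) (λ y → ⊕-cancelˡ _ (h (c ∷ y)))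

  linearQ : ∀ {n} → (Fin n → Permutation′ M) → Fin M → NQuasigroup n M
  linearQ π c = record
    { op = linear π c ; op-cong = linear-cong π c ; isQuasigroup = linear-isQuasigroup π c }

  sign : Fin 2 → Permutation′ M
  sign zero       = id
  sign (suc zero) = reverse

module Product {n M p C : ℕ} (base : NQuasigroup n M)
               (fam : Fin C → NQuasigroup n p) (fam-distinct : Distinct fam) where

  hi : Fin (M * p) → Fin M
  hi = quotient {M} p

  lo : Fin (M * p) → Fin p
  lo = remainder {M} p

  hi-combine : ∀ (u : Fin M) (v : Fin p) → hi (combine u v) ≡ u
  hi-combine u v = cong proj₁ (remQuot-combine u v)

  lo-combine : ∀ (u : Fin M) (v : Fin p) → lo (combine u v) ≡ v
  lo-combine u v = cong proj₂ (remQuot-combine u v)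

  combine-hi-lo : ∀ b → combine (hi b) (lo b) ≡ b
  combine-hi-lo = combine-remQuot {M} p

  combine-injective : ∀ {u u' : Fin M} {v v' : Fin p} → combine u v ≡ combine u' v' → u ≡ u' × v ≡ v'
  combine-injective {u} {u'} {v} {v'} = DFP.combine-injective u v u' v'

  label : Fin (C ^ (M ^ n)) → (Fin n → Fin M) → Fin C
  label t a = finToFun t (funToFin a)

  label-injective : ∀ {t t'} → (∀ a → label t a ≡ label t' a) → t ≡ t'
  label-injective {t} {t'} h = finToFun-injective {M ^ n} {C} λ j →
    subst (λ z → finToFun t z ≡ finToFun t' z) (funToFin-finToFin {n} {M} j) (h (finToFun j))

  productOp : Fin (C ^ (M ^ n)) → Op n (M * p)
  productOp t x = combine (op base (hi ∘ x)) (op (fam (label t (hi ∘ x))) (lo ∘ x))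

  productOp-decompose : ∀ t x {a e} → (∀ j → hi (x j) ≡ a j) → (∀ j → lo (x j) ≡ e j) →
                        productOp t x ≡ combine (op base a) (op (fam (label t a)) e)
  productOp-decompose t x hi≗a lo≗e = cong₂ combine (op-cong base hi≗a)
    (trans (cong (λ u → op (fam u) (lo ∘ x)) (cong (finToFun t) (funToFin-cong hi≗a)))
           (op-cong (fam _) lo≗e))

  productOp-cong : ∀ t {x y} → (∀ j → x j ≡ y j) → productOp t x ≡ productOp t y
  productOp-cong t {x} x≗y = productOp-decompose t x (cong hi ∘ x≗y) (cong lo ∘ x≗y)

  productOp-isQuasigroup : ∀ t → IsQuasigroup (productOp t)
  productOp-isQuasigroup t i x c = combine bₕ bₗ , solves , unique
    where
    open ≡-Reasoning
    valueAt : Fin M → Fin p → Fin (M * p)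
    valueAt u v = combine (op base ((hi ∘ x) [ i ]≔ u)) (op (fam (label t ((hi ∘ x) [ i ]≔ u))) ((lo ∘ x) [ i ]≔ v))
    update : ∀ b → productOp t (x [ i ]≔ b) ≡ valueAt (hi b) (lo b)
    update b = productOp-decompose t _ (map-[]≔ hi x i b) (map-[]≔ lo x i b)
    high-solution = isQuasigroup base i (hi ∘ x) (hi c)
    bₕ = proj₁ high-solution
    low-solution = isQuasigroup (fam (label t ((hi ∘ x) [ i ]≔ bₕ))) i (lo ∘ x) (lo c)
    bₗ = proj₁ low-solution
    bₕ-solves = proj₁ (proj₂ high-solution)
    bₗ-solves = proj₁ (proj₂ low-solution)
    solves : productOp t (x [ i ]≔ combine bₕ bₗ) ≡ c
    solves = begin
      productOp t (x [ i ]≔ combine bₕ bₗ)               ≡⟨ update (combine bₕ bₗ) ⟩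
      valueAt (hi (combine bₕ bₗ)) (lo (combine bₕ bₗ))  ≡⟨ cong₂ valueAt (hi-combine bₕ bₗ) (lo-combine bₕ bₗ) ⟩
      valueAt bₕ bₗ                                      ≡⟨ cong₂ combine bₕ-solves bₗ-solves ⟩
      combine (hi c) (lo c)                              ≡⟨ combine-hi-lo c ⟩
      c                                                  ∎
    unique : ∀ {b} → productOp t (x [ i ]≔ b) ≡ c → combine bₕ bₗ ≡ b
    unique {b} e = trans (cong₂ combine bₕ≡hi-b bₗ≡lo-b) (combine-hi-lo b)
      where
      components = combine-injective (trans (sym (update b)) (trans e (sym (combine-hi-lo c))))
      bₕ≡hi-b : bₕ ≡ hi b
      bₕ≡hi-b = proj₂ (proj₂ high-solution) (proj₁ components)
      bₗ≡lo-b : bₗ ≡ lo b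
      bₗ≡lo-b = proj₂ (proj₂ low-solution)
        (trans (cong (λ u → op (fam (label t ((hi ∘ x) [ i ]≔ u))) ((lo ∘ x) [ i ]≔ lo b)) bₕ≡hi-b)
               (proj₂ components))

  family : Fin (C ^ (M ^ n)) → NQuasigroup n (M * p)
  family t = record
    { op = productOp t ; op-cong = productOp-cong t ; isQuasigroup = productOp-isQuasigroup t }

  family-distinct : Distinct family
  family-distinct t t' h = label-injective λ a → fam-distinct _ _ λ e →
    let pair : Fin n → Fin (M * p)
        pair j = combine (a j) (e j)
        hi-pair = λ j → hi-combine (a j) (e j)
        lo-pair = λ j → lo-combine (a j) (e j)
    in proj₂ (combine-injective (begin
      combine (op base a) (op (fam (label t a)) e)   ≡⟨ productOp-decompose t pair hi-pair lo-pair ⟨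
      productOp t pair                               ≡⟨ h pair ⟩
      productOp t' pair                              ≡⟨ productOp-decompose t' pair hi-pair lo-pair ⟩
      combine (op base a) (op (fam (label t' a)) e)  ∎))
    where open ≡-Reasoning

cardAtLeast-multiple : ∀ {n p C} k .{{_ : NonZero p}} → k ≥ 1 → p ∣ k →
                       (fam : Fin C → NQuasigroup n p) → Distinct fam →
                       CardAtLeast n k (C ^ ((k / p) ^ n))
cardAtLeast-multiple {n} {p} {C} .(suc q * p) _ (divides (suc q) refl) fam fam-distinct =
  subst (λ m → CardAtLeast n (suc q * p) (C ^ (m ^ n))) (sym (m*n/n≡m (suc q) p))
        (distinct⇒cardAtLeast family family-distinct)
  where open Product (Linear.linearQ (suc q) (λ _ → id) zero) fam fam-distinct

translations : ∀ n → Fin 2 → NQuasigroup n 2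
translations n = Linear.linearQ 2 (λ _ → id)

translations-distinct : ∀ n → Distinct (translations n)
translations-distinct n _ _ = Linear.linear-const-injective 2 (λ _ → id)

module _ where

  open Cyclic 3
  open Linear 3

  translation≢reflection : ∀ (g g' : Fin 3) → ¬ (∀ u → u ⊕ g ≡ opposite u ⊕ g')
  translation≢reflection g g' h = 0≢2 (⊕-cancelʳ g (trans (h zero) (cong (opposite zero ⊕_) (sym g≡g'))))
    where
    g≡g' : g ≡ g'
    g≡g' = ⊕-cancelˡ (suc zero) (h (suc zero))
    0≢2 : zero ≢ opposite zero
    0≢2 ()

  sign-determined : ∀ {t t'} {g g' : Fin 3} →
                    (∀ u → (sign t ⟨$⟩ʳ u) ⊕ g ≡ (sign t' ⟨$⟩ʳ u) ⊕ g') → t ≡ t'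
  sign-determined {zero}     {zero}     _ = refl
  sign-determined {zero}     {suc zero} h = contradiction h (translation≢reflection _ _)
  sign-determined {suc zero} {zero}     h = contradiction (sym ∘ h) (translation≢reflection _ _)
  sign-determined {suc zero} {suc zero} _ = refl

  signs-determined : ∀ {n} (s s' : Fin n → Fin 2) {c c'} →
                     (∀ x → linear (sign ∘ s) c x ≡ linear (sign ∘ s') c' x) →
                     ∀ j → s j ≡ s' j
  signs-determined {suc n} s s' h zero = sign-determined (λ u → h (u ∷ λ _ → zero))
  signs-determined {suc n} s s' {c} {c'} h (suc j) = signs-determined (tail s) (tail s') tails-agree j
    where
    tails-agree : ∀ y → linear (sign ∘ tail s) c y ≡ linear (sign ∘ tail s') c' y
    tails-agree y = ⊕-cancelˡ (sign (s zero) ⟨$⟩ʳ zero) (trans (h (zero ∷ y))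
      (cong (λ σ → (sign σ ⟨$⟩ʳ zero) ⊕ linear (sign ∘ tail s') c' y) (sym (signs-determined s s' h zero))))

  signedLinear : ∀ n → Fin (3 * 2 ^ n) → NQuasigroup n 3
  signedLinear n t = linearQ (sign ∘ finToFun (remainder {3} (2 ^ n) t)) (quotient (2 ^ n) t)

  signedLinear-distinct : ∀ n → Distinct (signedLinear n)
  signedLinear-distinct n t t' h = begin
    t                                                       ≡⟨ combine-remQuot {3} (2 ^ n) t ⟨
    combine (quotient (2 ^ n) t) (remainder (2 ^ n) t)      ≡⟨ cong₂ combine c≡c' (finToFun-injective s≗s') ⟩
    combine (quotient (2 ^ n) t') (remainder (2 ^ n) t')    ≡⟨ combine-remQuot {3} (2 ^ n) t' ⟩
    t'                                                      ∎
    where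
    open ≡-Reasoning
    s = finToFun (remainder {3} (2 ^ n) t)
    s' = finToFun (remainder {3} (2 ^ n) t')
    s≗s' = signs-determined s s' h
    c≡c' = linear-const-injective (sign ∘ s) λ x →
      trans (h x) (sym (linear-congᵖ _ (λ j u → cong (λ σ → sign σ ⟨$⟩ʳ u) (s≗s' j)) x))

2^[n*m]<[3*2^n]^m : ∀ n {m} → m > 0 → 2 ^ (n * m) < (3 * 2 ^ n) ^ m
2^[n*m]<[3*2^n]^m n {m} m>0 =
  subst (_< (3 * 2 ^ n) ^ m) (^-*-assoc 2 n m) (^-monoˡ-< m {{>-nonZero m>0}} 2^n<3*2^n)
  where
  2^n<3*2^n : 2 ^ n < 3 * 2 ^ n
  2^n<3*2^n = subst (2 ^ n <_) (*-comm (2 ^ n) 3) (m<m*n (2 ^ n) 3 {{m^n≢0 2 n}} (s≤s (s≤s z≤n)))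

corollary2 : (n k : ℕ) → n ≥ 1 → k ≥ 1 →
    (2 ∣ k → CardAtLeast n k (2 ^ ((k / 2) ^ n))) ×
    (3 ∣ k → CardAtLeast n k ((3 * 2 ^ n) ^ ((k / 3) ^ n)) × (2 ^ (n * (k / 3) ^ n) < (3 * 2 ^ n) ^ ((k / 3) ^ n)))
corollary2 n k _ k≥1 =
  (λ 2∣k → cardAtLeast-multiple k k≥1 2∣k (translations n) (translations-distinct n)) ,
  (λ 3∣k → cardAtLeast-multiple k k≥1 3∣k (signedLinear n) (signedLinear-distinct n) ,
           2^[n*m]<[3*2^n]^m n (m^n>0 (k / 3) {{>-nonZero (k/3>0 3∣k)}} n))
  where
  k/3>0 : 3 ∣ k → k / 3 > 0
  k/3>0 3∣k = m≥n⇒m/n>0 (∣⇒≤ {{>-nonZero k≥1}} 3∣k)
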